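{- Let $G$ be a graph on $n$ vertices with degree sequence $d_1\ge\cdots\ge d_n$ and let $m=\max\{i:d_i\ge i-1\}$. Then $G$ is an NG-1 graph or an NG-2 graph if and only if $\sum_{i=1}^m d_i = m(m-1)+\sum_{i=m+1}^n d_i$ and $d_m=m-1$.
   Context: Graphs are finite and simple; $\chi$ is the chromatic number and $\overline{G}$ the complement. A graph $G$ is an NG-graph if $\chi(G)+\chi(\overline{G})=|V(G)|+1$. The ABC-partition of $V(G)$ is $A=\{v:\deg(v)=\chi(G)-1\}$, $B=\{v:\deg(v)>\chi(G)-1\}$, $C=\{v:\deg(v)<\chi(G)-1\}$. An NG-1 graph is an NG-graph in which $G[A]$ is a clique; an NG-2 graph is an NG-graph in which $G[A]$ is a stable set. -}

module Defs where

open import Data.Nat using (ℕ; zero; suc; _+_; _*_; _∸_; _≤_; _<_)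
open import Data.Bool using (Bool; true; false; not; if_then_else_)
open import Data.Fin using (Fin; toℕ; _≟_)
open import Data.List using (List; take; drop)
open import Data.Nat.ListAction using (sum)
open import Data.Vec.Functional using (toList)
open import Data.Product using (Σ; _×_; _,_)
open import Data.Sum using (_⊎_)
open import Relation.Nullary using (¬_; yes; no)
open import Relation.Binary.PropositionalEquality using (_≡_; refl; sym)

record Graph (n : ℕ) : Set where
  field
    adj    : Fin n → Fin n → Bool
    adj-sym    : ∀ u v → adj u v ≡ adj v u
    adj-irrefl : ∀ v → adj v v ≡ false
open Graph public

complement : ∀ {n} → Graph n → Graph n
complement {n} G = record { adj = a ; adj-sym = s ; adj-irrefl = i }
  where
  a : Fin n → Fin n → Bool
  a u v with u ≟ v
  ... | yes _ = false
  ... | no  _ = not (adj G u v)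
  s : ∀ u v → a u v ≡ a v u
  s u v with u ≟ v | v ≟ u
  ... | yes _ | yes _ = refl
  ... | yes p | no q = Data.Empty.⊥-elim (q (sym p))
    where import Data.Empty
  ... | no q | yes p = Data.Empty.⊥-elim (q (sym p))
    where import Data.Empty
  ... | no _ | no _ rewrite adj-sym G u v = refl
  i : ∀ v → a v v ≡ false
  i v with v ≟ v
  ... | yes _ = refl
  ... | no q = Data.Empty.⊥-elim (q refl)
    where import Data.Empty

deg : ∀ {n} → Graph n → Fin n → ℕ
deg G v = sum (toList (λ u → if adj G v u then 1 else 0))

Colourable : ∀ {n} → Graph n → ℕ → Set
Colourable {n} G k =
  Σ (Fin n → Fin k) λ c → ∀ u v → adj G u v ≡ true → ¬ (c u ≡ c v)

IsChromatic : ∀ {n} → Graph n → ℕ → Set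
IsChromatic G k = Colourable G k × (∀ j → Colourable G j → k ≤ j)

IsNG : ∀ {n} → Graph n → Set
IsNG {n} G = Σ ℕ λ k → Σ ℕ λ k' →
  IsChromatic G k × IsChromatic (complement G) k' × (k + k' ≡ n + 1)

-- Membership in part A of the ABC-partition, given k = χ(G).
InA : ∀ {n} → Graph n → ℕ → Fin n → Set
InA G k v = deg G v ≡ k ∸ 1

IsNG1 : ∀ {n} → Graph n → Set
IsNG1 {n} G = IsNG G × Σ ℕ λ k → IsChromatic G k ×
  (∀ u v → ¬ (u ≡ v) → InA G k u → InA G k v → adj G u v ≡ true)

IsNG2 : ∀ {n} → Graph n → Set
IsNG2 {n} G = IsNG G × Σ ℕ λ k → IsChromatic G k ×
  (∀ u v → InA G k u → InA G k v → adj G u v ≡ false)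

-- d (indexed by Fin n, position i ↦ d_{i+1}) is a degree sequence of G
-- in non-increasing order: d_{i+1} = deg(π i) for a permutation π.
IsSortedDegSeq : ∀ {n} → Graph n → (Fin n → ℕ) → Set
IsSortedDegSeq {n} G d =
  (Σ (Fin n → Fin n) λ π → (Σ (Fin n → Fin n) λ ρ →
      (∀ i → π (ρ i) ≡ i) × (∀ i → ρ (π i) ≡ i))
    × (∀ i → d i ≡ deg G (π i)))
  × (∀ (i j : Fin n) → toℕ i ≤ toℕ j → d j ≤ d i)

-- m = max { i ∈ {1..n} : d_i ≥ i - 1 }  (1-indexed; d_{t+1} = d t).
IsM : ∀ {n} → (Fin n → ℕ) → ℕ → Set
IsM {n} d m =
  (Σ (Fin n) λ i → suc (toℕ i) ≡ m × toℕ i ≤ d i)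
  × (∀ (i : Fin n) → m < suc (toℕ i) → d i < toℕ i)

sumUpTo : ∀ {n} → (Fin n → ℕ) → ℕ → ℕ
sumUpTo d m = sum (take m (toList d))

sumFrom : ∀ {n} → (Fin n → ℕ) → ℕ → ℕ
sumFrom d m = sum (drop m (toList d))

DmIs : ∀ {n} → (Fin n → ℕ) → ℕ → Set
DmIs {n} d m = ∀ (i : Fin n) → suc (toℕ i) ≡ m → d i ≡ m ∸ 1

module Submission where

-- List the vertices by non-increasing degree and let X be the first
-- m of them.  By double counting of edges, the degree condition holds iff X
-- is a clique and the remaining vertices Y form a stable set (and d_m = m - 1).
--   (⇐) Then χ(G) = m (X is a clique; the vertices of Y have degree < m, so
-- greedy colouring succeeds), χ(Ḡ) = n - m + 1 (the vertex m and Y form a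
-- clique of Ḡ; X has small Ḡ-degree), and part A is a clique or stable.
--   (⇒) With χ(G) = k₀ + 1, χ(Ḡ) = k₁ + 1 and n = k₀ + k₁ + 1, a k₀-core of G
-- and a k₁-core of Ḡ (which exist by greedy colouring) must share a vertex v;
-- using that A is a clique, N[v] is a clique of size k₀ + 1 and the other
-- vertices are stable (a non-edge among them could be contracted to colour
-- Ḡ with k₁ colours).  If A is stable the same holds, applying the argument
-- to Ḡ.  Reading this off the sorted order gives m = k₀ + 1 and the condition.

open import Defs
open import Data.Nat using (ℕ; _+_; _*_; _∸_)
open import Data.Fin using (Fin)
open import Data.Product using (_×_)
open import Data.Sum using (_⊎_)
open import Function.Bundles using (_⇔_; mk⇔; Equivalence)
open import Relation.Binary.PropositionalEquality using (_≡_)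

open import Data.Nat using (zero; suc; _≤_; _<_; _≰_; _≤ᵇ_; _<ᵇ_; z≤n; s≤s; s≤s⁻¹; _≤?_; _<?_)
open import Data.Nat.Properties
import Data.Nat.ListAction as ListAction
open import Data.Fin as Fin using (toℕ; fromℕ<; inject≤) renaming (zero to fzero; suc to fsuc)
open import Data.Fin.Properties using (toℕ-injective; toℕ-fromℕ<; toℕ<n; toℕ-inject≤; any?; all?; ¬∀⟶∃¬; pigeonhole)
import Data.Fin.Properties as FinP
open import Data.Fin.Permutation using (permutation)
open import Data.Bool using (Bool; true; false; not; _∧_; _∨_; if_then_else_)
open import Data.Bool.Properties using (∧-conicalˡ; ∧-conicalʳ; ∨-conicalˡ; ∨-conicalʳ; ∧-zeroʳ; ∨-zeroʳ; ∨-comm; T-≡)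
import Data.Bool.Properties as BoolP
open import Data.Product using (Σ; _,_; proj₁; proj₂)
open import Data.Sum using (inj₁; inj₂)
open import Data.Empty using (⊥; ⊥-elim)
open import Data.List using (take; drop)
open import Data.Vec.Functional using (toList)
open import Function using (_∘_)
open import Relation.Nullary using (¬_; Dec; yes; no; does; contradiction)
open import Relation.Nullary.Decidable using (_×-dec_)
import Data.Sum
open import Relation.Binary.PropositionalEquality using (_≢_; refl; sym; trans; cong; cong₂; subst; subst₂; module ≡-Reasoning)
open import Algebra.Properties.Semiring.Sum +-*-semiring
  using (sum; sum-syntax; sum-cong-≗; ∑-distrib-+; ∑-comm; sum-permute; sum-replicate-zero; *-distribʳ-sum)

sum-toList : ∀ {n} (f : Fin n → ℕ) → ListAction.sum (toList f) ≡ sum f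
sum-toList {zero}  f = refl
sum-toList {suc n} f = cong (f fzero +_) (sum-toList (f ∘ fsuc))

sum-mono : ∀ {n} {f g : Fin n → ℕ} → (∀ u → f u ≤ g u) → sum f ≤ sum g
sum-mono {zero}  f≤g = z≤n
sum-mono {suc n} f≤g = +-mono-≤ (f≤g fzero) (sum-mono (f≤g ∘ fsuc))

sum-rigid : ∀ {n} {f g : Fin n → ℕ} → (∀ u → f u ≤ g u) → sum g ≤ sum f →
  ∀ u → f u ≡ g u
sum-rigid {suc n} {f} {g} f≤g Σg≤Σf fzero = ≤-antisym (f≤g fzero)
  (+-cancelʳ-≤ (sum (g ∘ fsuc)) _ _
    (≤-trans Σg≤Σf (+-monoʳ-≤ (f fzero) (sum-mono (f≤g ∘ fsuc)))))
sum-rigid {suc n} {f} {g} f≤g Σg≤Σf (fsuc u) = sum-rigid (f≤g ∘ fsuc)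
  (+-cancelˡ-≤ (g fzero) _ _
    (≤-trans Σg≤Σf (+-monoˡ-≤ (sum (f ∘ fsuc)) (f≤g fzero)))) u

sum-zero : ∀ {n} (f : Fin n → ℕ) → sum f ≡ 0 → ∀ u → f u ≡ 0
sum-zero {suc n} f Σf≡0 fzero    = m+n≡0⇒m≡0 (f fzero) Σf≡0
sum-zero {suc n} f Σf≡0 (fsuc u) = sum-zero (f ∘ fsuc) (m+n≡0⇒n≡0 (f fzero) Σf≡0) u

sum-positive : ∀ {n} (f : Fin n → ℕ) → 0 < sum f → Σ (Fin n) λ u → 0 < f u
sum-positive {suc n} f 0<Σf with f fzero in eq
... | suc _ = fzero , subst (0 <_) (sym eq) (s≤s z≤n)
... | zero with sum-positive (f ∘ fsuc) 0<Σf
...   | u , 0<fu = fsuc u , 0<fu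

Subset : ℕ → Set
Subset n = Fin n → Bool

bit : Bool → ℕ
bit b = if b then 1 else 0

count : ∀ {n} → Subset n → ℕ
count {n} P = ∑[ u < n ] bit (P u)

infix 4 _⊆_
infix 8 _≡ᵇ_
infixl 6 _─_ _∩_

_⊆_ : ∀ {n} → Subset n → Subset n → Set
P ⊆ Q = ∀ u → P u ≡ true → Q u ≡ true

_∩_ : ∀ {n} → Subset n → Subset n → Subset n
P ∩ Q = λ u → P u ∧ Q u

∁ : ∀ {n} → Subset n → Subset n
∁ P = λ u → not (P u)

_≡ᵇ_ : ∀ {n} → Fin n → Fin n → Bool
u ≡ᵇ v = does (u Fin.≟ v)

_─_ : ∀ {n} → Subset n → Fin n → Subset n
P ─ v = λ u → P u ∧ not (u ≡ᵇ v)

∧-intro : ∀ {x y} → x ≡ true → y ≡ true → x ∧ y ≡ true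
∧-intro refl refl = refl

not-true : ∀ {x} → not x ≡ true → x ≡ false
not-true {false} _ = refl

not-false : ∀ {x} → x ≡ false → not x ≡ true
not-false refl = refl

not≡false : ∀ {x} → not x ≡ false → x ≡ true
not≡false {true} _ = refl

true≢false : ∀ {x} → x ≡ true → x ≡ false → ⊥
true≢false refl ()

∨-true : ∀ {x y} → x ∨ y ≡ true → x ≡ true ⊎ y ≡ true
∨-true {true}  _ = inj₁ refl
∨-true {false} e = inj₂ e

≡ᵇ-refl : ∀ {n} (u : Fin n) → (u ≡ᵇ u) ≡ true
≡ᵇ-refl u with u Fin.≟ u
... | yes _   = refl
... | no u≢u = contradiction refl u≢u

≡ᵇ-≢ : ∀ {n} {u v : Fin n} → u ≢ v → (u ≡ᵇ v) ≡ false
≡ᵇ-≢ {u = u} {v} u≢v with u Fin.≟ v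
... | yes u≡v = contradiction u≡v u≢v
... | no _    = refl

≡ᵇ-sound : ∀ {n} {u v : Fin n} → (u ≡ᵇ v) ≡ true → u ≡ v
≡ᵇ-sound {u = u} {v} eq with u Fin.≟ v
... | yes u≡v = u≡v

≡ᵇ-false : ∀ {n} {u v : Fin n} → (u ≡ᵇ v) ≡ false → u ≢ v
≡ᵇ-false {u = u} e refl = true≢false (≡ᵇ-refl u) e

─-intro : ∀ {n} {P : Subset n} {u v} → P u ≡ true → u ≢ v → (P ─ v) u ≡ true
─-intro Pu u≢v rewrite Pu | ≡ᵇ-≢ u≢v = refl

─-elim : ∀ {n} {P : Subset n} {u v} → (P ─ v) u ≡ true → P u ≡ true × u ≢ v
─-elim {P = P} {u} {v} e =
  ∧-conicalˡ (P u) _ e , λ { refl → true≢false (∧-conicalʳ (P u) _ e) (cong not (≡ᵇ-refl u)) }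

bit≤1 : ∀ b → bit b ≤ 1
bit≤1 false = z≤n
bit≤1 true  = ≤-refl

bit-mono : ∀ {x y} → (x ≡ true → y ≡ true) → bit x ≤ bit y
bit-mono {false} _ = z≤n
bit-mono {true}  x⇒y rewrite x⇒y refl = ≤-refl

count-cong : ∀ {n} {P Q : Subset n} → (∀ u → P u ≡ Q u) → count P ≡ count Q
count-cong P≗Q = sum-cong-≗ (λ u → cong bit (P≗Q u))

count-mono : ∀ {n} {P Q : Subset n} → P ⊆ Q → count P ≤ count Q
count-mono P⊆Q = sum-mono (λ u → bit-mono (P⊆Q u))

count-all : ∀ n → count {n} (λ _ → true) ≡ n
count-all zero    = refl
count-all (suc n) = cong suc (count-all n)

count-≤ : ∀ {n} (P : Subset n) → count P ≤ n
count-≤ {n} P = subst (count P ≤_) (count-all n) (sum-mono (λ u → bit≤1 (P u)))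

count-empty : ∀ {n} {P : Subset n} → count P ≡ 0 → ∀ u → P u ≡ false
count-empty {P = P} count≡0 u with P u | sum-zero (λ w → bit (P w)) count≡0 u
... | false | _ = refl

count-nonempty : ∀ {n} {P : Subset n} → 0 < count P → Σ (Fin n) λ u → P u ≡ true
count-nonempty {P = P} 0<count with sum-positive (λ w → bit (P w)) 0<count
... | u , 0<bit with P u in Pu
...   | true = u , Pu

count-singleton : ∀ {n} (v : Fin n) → count (_≡ᵇ v) ≡ 1
count-singleton {suc n} fzero    = cong suc (sum-replicate-zero n)
count-singleton {suc n} (fsuc v) = count-singleton v

count-remove : ∀ {n} (P : Subset n) {v} → P v ≡ true → count P ≡ suc (count (P ─ v))
count-remove {n} P {v} Pv = begin
  count P                                           ≡⟨ sum-cong-≗ split ⟩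
  ∑[ u < n ] (bit ((P ─ v) u) + bit (u ≡ᵇ v))       ≡⟨ ∑-distrib-+ (λ u → bit ((P ─ v) u)) (λ u → bit (u ≡ᵇ v)) ⟩
  count (P ─ v) + count (_≡ᵇ v)                     ≡⟨ cong (count (P ─ v) +_) (count-singleton v) ⟩
  count (P ─ v) + 1                                 ≡⟨ +-comm _ 1 ⟩
  suc (count (P ─ v))                               ∎
  where
  open ≡-Reasoning
  split : ∀ u → bit (P u) ≡ bit ((P ─ v) u) + bit (u ≡ᵇ v)
  split u with u Fin.≟ v
  ... | yes refl rewrite Pv = refl
  ... | no _ with P u
  ...   | true  = refl
  ...   | false = refl

count-⊆-eq : ∀ {n} {P Q : Subset n} → P ⊆ Q → count Q ≤ count P → Q ⊆ P
count-⊆-eq {P = P} {Q} P⊆Q Q≤P u Qu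
  with P u | sum-rigid (λ w → bit-mono (P⊆Q w)) Q≤P u
... | true | _ = refl
... | false | bits rewrite Qu = contradiction bits λ ()

count-∁ : ∀ {n} (P : Subset n) → count P + count (∁ P) ≡ n
count-∁ {n} P = begin
  count P + count (∁ P)               ≡⟨ ∑-distrib-+ (λ u → bit (P u)) (λ u → bit (not (P u))) ⟨
  ∑[ u < n ] (bit (P u) + bit (not (P u))) ≡⟨ sum-cong-≗ one ⟩
  count {n} (λ _ → true)              ≡⟨ count-all n ⟩
  n                                   ∎
  where
  open ≡-Reasoning
  one : ∀ u → bit (P u) + bit (not (P u)) ≡ 1
  one u with P u
  ... | true  = refl
  ... | false = refl

count-∩ : ∀ {n} (P Q : Subset n) → count P + count Q ≤ n + count (P ∩ Q)
count-∩ {n} P Q = subst₂ _≤_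
  (∑-distrib-+ (λ u → bit (P u)) (λ u → bit (Q u)))
  (trans (∑-distrib-+ (λ _ → 1) (λ u → bit (P u ∧ Q u))) (cong (_+ count (P ∩ Q)) (count-all n)))
  (sum-mono pointwise)
  where
  pointwise : ∀ u → bit (P u) + bit (Q u) ≤ 1 + bit (P u ∧ Q u)
  pointwise u with P u | Q u
  ... | true  | true  = ≤-refl
  ... | true  | false = ≤-refl
  ... | false | true  = ≤-refl
  ... | false | false = z≤n

Prefix : ∀ {n} → ℕ → Subset n
Prefix m = λ i → toℕ i <ᵇ m

count-Prefix : ∀ {n} m → m ≤ n → count {n} (Prefix m) ≡ m
count-Prefix {n}     zero    _         = sum-replicate-zero n
count-Prefix {suc n} (suc m) (s≤s m≤n) = cong suc (count-Prefix {n} m m≤n)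

count-injection : ∀ {k n} (P : Subset n) (g : Fin k → Fin n) →
  (∀ i j → g i ≡ g j → i ≡ j) → (∀ i → P (g i) ≡ true) → k ≤ count P
count-injection {zero}  P g g-inj g∈P = z≤n
count-injection {suc k} P g g-inj g∈P rewrite count-remove P (g∈P fzero) =
  s≤s (count-injection (P ─ g fzero) (g ∘ fsuc)
        (λ i j eq → FinP.suc-injective (g-inj (fsuc i) (fsuc j) eq))
        (λ i → ─-intro {P = P} (g∈P (fsuc i)) (λ eq → FinP.0≢1+n (sym (g-inj (fsuc i) fzero eq)))))

Clique : ∀ {n} → Graph n → Subset n → Set
Clique G X = ∀ x y → x ≢ y → X x ≡ true → X y ≡ true → adj G x y ≡ true

Stable : ∀ {n} → Graph n → Subset n → Set
Stable G X = ∀ x y → X x ≡ true → X y ≡ true → adj G x y ≡ false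

closedNbhd : ∀ {n} → Graph n → Fin n → Subset n
closedNbhd G v = λ u → (u ≡ᵇ v) ∨ adj G v u

closedNbhd-other : ∀ {n} (G : Graph n) {v x} → x ≢ v → closedNbhd G v x ≡ true → adj G v x ≡ true
closedNbhd-other G {v} {x} x≢v e rewrite ≡ᵇ-≢ x≢v = e

outside-closedNbhd : ∀ {n} (G : Graph n) {v x} → closedNbhd G v x ≡ false → x ≢ v × adj G v x ≡ false
outside-closedNbhd G {v} {x} e = ≡ᵇ-false (∨-conicalˡ (x ≡ᵇ v) _ e) , ∨-conicalʳ (x ≡ᵇ v) _ e

nbhd∩⊆─ : ∀ {n} (G : Graph n) (X : Subset n) (x : Fin n) → adj G x ∩ X ⊆ X ─ x
nbhd∩⊆─ G X x u e = ─-intro {P = X} (∧-conicalʳ (adj G x u) _ e)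
  λ { refl → true≢false (∧-conicalˡ (adj G x x) _ e) (adj-irrefl G x) }

count-closedNbhd : ∀ {n} (G : Graph n) v → count (closedNbhd G v) ≡ suc (count (adj G v))
count-closedNbhd G v =
  trans (count-remove (closedNbhd G v) {v} (cong (_∨ adj G v v) (≡ᵇ-refl v)))
        (cong suc (count-cong drop-v))
  where
  drop-v : ∀ u → (closedNbhd G v ─ v) u ≡ adj G v u
  drop-v u with u Fin.≟ v
  ... | yes refl = sym (adj-irrefl G v)
  ... | no _ with adj G v u
  ...   | true  = refl
  ...   | false = refl

ColourableOn : ∀ {n} → Graph n → ℕ → Subset n → Set
ColourableOn {n} G k X = Σ (Fin n → Fin k) λ c →
  ∀ u v → X u ≡ true → X v ≡ true → adj G u v ≡ true → c u ≢ c v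

colour-used? : ∀ {n k} (c : Fin n → Fin k) (P : Subset n) (col : Fin k) →
  Dec (Σ (Fin n) λ u → P u ≡ true × c u ≡ col)
colour-used? c P col = any? (λ u → (P u BoolP.≟ true) ×-dec (c u Fin.≟ col))

free-colour : ∀ {n k} (c : Fin n → Fin k) (P : Subset n) → count P < k →
  Σ (Fin k) λ col → ∀ u → P u ≡ true → c u ≢ col
free-colour {k = k} c P small with all? (colour-used? c P)
... | yes allUsed =
  contradiction (count-injection P (proj₁ ∘ allUsed) section-inj (proj₁ ∘ proj₂ ∘ allUsed)) (<⇒≱ small)
  where
  section-inj : ∀ i j → proj₁ (allUsed i) ≡ proj₁ (allUsed j) → i ≡ j
  section-inj i j eq =
    trans (sym (proj₂ (proj₂ (allUsed i)))) (trans (cong c eq) (proj₂ (proj₂ (allUsed j))))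
... | no notAll with ¬∀⟶∃¬ k _ (colour-used? c P) notAll
...   | col , unused = col , λ u Pu cu≡col → unused (u , Pu , cu≡col)

colour-extend : ∀ {n} (G : Graph n) {k} X x → X x ≡ true → count (adj G x ∩ X) < k →
  ColourableOn G k (X ─ x) → ColourableOn G k X
colour-extend G {k} X x Xx sparse (c , proper) = c′ , proper′
  where
  free = free-colour c (adj G x ∩ (X ─ x))
    (≤-<-trans (count-mono λ u e → ∧-intro (∧-conicalˡ (adj G x u) _ e)
                                            (proj₁ (─-elim {P = X} (∧-conicalʳ (adj G x u) _ e))))
               sparse)
  col = proj₁ free
  c′ : _ → Fin k
  c′ u = if u ≡ᵇ x then col else c u
  proper′ : ∀ u v → X u ≡ true → X v ≡ true → adj G u v ≡ true → c′ u ≢ c′ v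
  proper′ u v Xu Xv uv with u Fin.≟ x | v Fin.≟ x
  ... | yes refl | yes refl = λ _ → true≢false uv (adj-irrefl G x)
  ... | yes refl | no v≢x   = λ eq →
    proj₂ free v (∧-intro uv (─-intro {P = X} Xv v≢x)) (sym eq)
  ... | no u≢x   | yes refl = λ eq →
    proj₂ free u (∧-intro (trans (adj-sym G x u) uv) (─-intro {P = X} Xu u≢x)) eq
  ... | no u≢x   | no v≢x   = proper u v (─-intro {P = X} Xu u≢x) (─-intro {P = X} Xv v≢x) uv

MinDegreeIn : ∀ {n} → Graph n → ℕ → Subset n → Set
MinDegreeIn G k X = ∀ x → X x ≡ true → k ≤ count (adj G x ∩ X)

Core : ∀ {n} → Graph n → ℕ → Set
Core {n} G k = Σ (Subset n) λ X → (Σ (Fin n) λ x → X x ≡ true) × MinDegreeIn G k X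

-- Greedy colouring of X by removing low-degree vertices one at a time:
-- either X is (suc k)-colourable or the process gets stuck on a core.
colour-or-core-on : ∀ {n} (G : Graph n) k (t : ℕ) (X : Subset n) → count X ≤ t →
  ColourableOn G (suc k) X ⊎ Core G (suc k)
colour-or-core-on G k zero X empty =
  inj₁ ((λ _ → fzero) , λ u v Xu → contradiction (count-empty (n≤0⇒n≡0 empty) u) (true≢false Xu))
colour-or-core-on G k (suc t) X size
  with any? (λ x → (X x BoolP.≟ true) ×-dec (count (adj G x ∩ X) <? suc k))
... | yes (x , Xx , sparse) =
  Data.Sum.map₁ (colour-extend G X x Xx sparse) (colour-or-core-on G k t (X ─ x) smaller)
  where
  smaller : count (X ─ x) ≤ t
  smaller = s≤s⁻¹ (subst (_≤ suc t) (count-remove X Xx) size)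
... | no dense with any? (λ x → X x BoolP.≟ true)
...   | yes (x , Xx) = inj₂ (X , (x , Xx) , λ y Xy → ≮⇒≥ (λ lt → dense (y , Xy , lt)))
...   | no empty     = inj₁ ((λ _ → fzero) , λ u v Xu → contradiction (u , Xu) empty)

colourable-or-core : ∀ {n} (G : Graph n) (k : ℕ) → Colourable G k ⊎ Core G k
colourable-or-core {zero}  G k       = inj₁ ((λ ()) , λ ())
colourable-or-core {suc n} G zero    = inj₂ ((λ _ → true) , (fzero , refl) , λ _ _ → z≤n)
colourable-or-core {suc n} G (suc k) =
  Data.Sum.map₁ (λ (c , proper) → c , λ u v → proper u v refl refl)
    (colour-or-core-on G k (suc n) (λ _ → true) (count-≤ (λ _ → true)))

core-of-uncolourable : ∀ {n} (G : Graph n) {k} → ¬ Colourable G k → Core G k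
core-of-uncolourable G {k} uncolourable with colourable-or-core G k
... | inj₁ c    = contradiction c uncolourable
... | inj₂ core = core

uncolourable-below : ∀ {n} (G : Graph n) {k} → IsChromatic G (suc k) → ¬ Colourable G k
uncolourable-below G {k} χ c = 1+n≰n (proj₂ χ k c)

core-size : ∀ {n} (G : Graph n) {k} (C : Core G k) → suc k ≤ count (proj₁ C)
core-size G {k} (X , (x , Xx) , dense) rewrite count-remove X Xx =
  s≤s (≤-trans (dense x Xx) (count-mono (nbhd∩⊆─ G X x)))

-- If the vertices outside a set W of at most k vertices all have degree
-- below k, then G is k-colourable: a k-core can neither leave W nor fit in it.
colourable-outside-small : ∀ {n} (G : Graph n) {k} (W : Subset n) → count W ≤ k →
  (∀ x → W x ≡ false → count (adj G x) < k) → Colourable G k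
colourable-outside-small G {k} W small sparse with colourable-or-core G k
... | inj₁ c = c
... | inj₂ (Z , (z , Zz) , dense) with any? (λ s → (Z s BoolP.≟ true) ×-dec (W s BoolP.≟ false))
...   | yes (s , Zs , Ws) =
  contradiction (≤-trans (dense s Zs) (count-mono λ u e → ∧-conicalˡ (adj G s u) _ e)) (<⇒≱ (sparse s Ws))
...   | no Z⊆W = contradiction
  (≤-trans (core-size G (Z , (z , Zz) , dense)) (≤-trans (count-mono inW) small)) 1+n≰n
  where
  inW : Z ⊆ W
  inW u Zu with W u in Wu
  ... | true  = refl
  ... | false = contradiction (u , Zu , Wu) Z⊆W

clique-needs-colours : ∀ {n m} (G : Graph n) (g : Fin m → Fin n) →
  (∀ i j → toℕ i < toℕ j → adj G (g i) (g j) ≡ true) → ∀ j → Colourable G j → m ≤ j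
clique-needs-colours {m = m} G g clique j (c , proper) with m ≤? j
... | yes m≤j = m≤j
... | no m≰j with pigeonhole (≰⇒> m≰j) (c ∘ g)
...   | i , i′ , i<i′ , same = contradiction same (proper (g i) (g i′) (clique i i′ i<i′))

nbhd-inside : ∀ {n} (G : Graph n) {k X u} → MinDegreeIn G k X → X u ≡ true →
  count (adj G u) ≡ k → adj G u ⊆ X
nbhd-inside G {k} {X} {u} dense Xu deg≡k w e =
  ∧-conicalʳ (adj G u w) _
    (count-⊆-eq {P = adj G u ∩ X} {Q = adj G u} (λ w e → ∧-conicalˡ (adj G u w) _ e)
      (subst (_≤ count (adj G u ∩ X)) (sym deg≡k) (dense u Xu)) w e)

tight-set-is-clique : ∀ {n} (G : Graph n) {k X} → MinDegreeIn G k X → count X ≡ suc k → Clique G X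
tight-set-is-clique G {k} {X} dense |X| x y x≢y Xx Xy =
  ∧-conicalˡ (adj G x y) _
    (count-⊆-eq (nbhd∩⊆─ G X x) others≤ y (─-intro {P = X} Xy (λ y≡x → x≢y (sym y≡x))))
  where
  others≤ : count (X ─ x) ≤ count (adj G x ∩ X)
  others≤ = subst (_≤ count (adj G x ∩ X)) (sym (suc-injective (trans (sym (count-remove X Xx)) |X|))) (dense x Xx)

-- Contracting a non-edge s₁ s₂: s₂ is merged into s₁ (and left isolated).
-- A colouring of the contracted graph pulls back to one of G.
module Contraction {n} (G : Graph n) (s₁ s₂ : Fin n) (s₁≢s₂ : s₁ ≢ s₂) (non-edge : adj G s₁ s₂ ≡ false) where

  merged : Fin n → Fin n → Bool
  merged x y = not (x ≡ᵇ s₂) ∧ (not (y ≡ᵇ s₂) ∧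
    (adj G x y ∨ ((x ≡ᵇ s₁ ∧ adj G s₂ y) ∨ (y ≡ᵇ s₁ ∧ adj G x s₂))))

  private
    shape : ∀ p q r s t → p ∧ (q ∧ (r ∨ (s ∨ t))) ≡ q ∧ (p ∧ (r ∨ (t ∨ s)))
    shape false false _ _ _ = refl
    shape false true  _ _ _ = refl
    shape true  false _ _ _ = refl
    shape true  true  true  _ _ = refl
    shape true  true  false s t = ∨-comm s t

    ∧-twice-false : ∀ p → p ∧ (p ∧ false) ≡ false
    ∧-twice-false false = refl
    ∧-twice-false true  = refl

  merged-sym : ∀ x y → merged x y ≡ merged y x
  merged-sym x y rewrite adj-sym G y x | adj-sym G s₂ x | adj-sym G y s₂ =
    shape (not (x ≡ᵇ s₂)) (not (y ≡ᵇ s₂)) (adj G x y) (x ≡ᵇ s₁ ∧ adj G s₂ y) (y ≡ᵇ s₁ ∧ adj G x s₂)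

  merged-irrefl : ∀ x → merged x x ≡ false
  merged-irrefl x with x Fin.≟ s₁
  ... | yes refl rewrite adj-irrefl G s₁ | non-edge | adj-sym G s₂ s₁ | non-edge =
    ∧-twice-false (not (s₁ ≡ᵇ s₂))
  ... | no _ rewrite adj-irrefl G x = ∧-twice-false (not (x ≡ᵇ s₂))

  G/ : Graph n
  G/ = record { adj = merged ; adj-sym = merged-sym ; adj-irrefl = merged-irrefl }

  redirect : Fin n → Fin n
  redirect x = if x ≡ᵇ s₂ then s₁ else x

  from-s₂ : ∀ y → y ≢ s₂ → adj G s₂ y ≡ true → merged s₁ y ≡ true
  from-s₂ y y≢s₂ e rewrite ≡ᵇ-≢ s₁≢s₂ | ≡ᵇ-≢ y≢s₂ | ≡ᵇ-refl s₁ | e = ∨-zeroʳ (adj G s₁ y)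

  redirect-adj : ∀ x y → adj G x y ≡ true → merged (redirect x) (redirect y) ≡ true
  redirect-adj x y e with x Fin.≟ s₂ | y Fin.≟ s₂
  ... | yes refl | yes refl = contradiction (adj-irrefl G s₂) (true≢false e)
  ... | yes refl | no y≢s₂  = from-s₂ y y≢s₂ e
  ... | no x≢s₂  | yes refl = trans (merged-sym x s₁) (from-s₂ x x≢s₂ (trans (adj-sym G s₂ x) e))
  ... | no x≢s₂  | no y≢s₂  rewrite ≡ᵇ-≢ x≢s₂ | ≡ᵇ-≢ y≢s₂ | e = refl

  lift : ∀ {k} → Colourable G/ k → Colourable G k
  lift (c , proper) = c ∘ redirect , λ x y e → proper (redirect x) (redirect y) (redirect-adj x y e)

  merged-edge : ∀ {x y} → merged x y ≡ true → y ≢ s₂ × (adj G x y ≡ true ⊎ x ≡ s₁ ⊎ y ≡ s₁)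
  merged-edge {x} {y} e = ≡ᵇ-false (not-true (∧-conicalˡ _ _ after-x)) , origin
    where
    after-x = ∧-conicalʳ (not (x ≡ᵇ s₂)) _ e
    origin : adj G x y ≡ true ⊎ x ≡ s₁ ⊎ y ≡ s₁
    origin with ∨-true {adj G x y} (∧-conicalʳ (not (y ≡ᵇ s₂)) _ after-x)
    ... | inj₁ xy = inj₁ xy
    ... | inj₂ via-s₁ with ∨-true {x ≡ᵇ s₁ ∧ adj G s₂ y} via-s₁
    ...   | inj₁ at-x = inj₂ (inj₁ (≡ᵇ-sound (∧-conicalˡ (x ≡ᵇ s₁) _ at-x)))
    ...   | inj₂ at-y = inj₂ (inj₂ (≡ᵇ-sound (∧-conicalˡ (y ≡ᵇ s₁) _ at-y)))

  -- Let s₁, s₂ lie in a k-element set S whose complement is stable.  Then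
  -- G/ has no k-core: s₂ is isolated, vertices outside S only see S ─ s₂,
  -- so a core would fit inside S ─ s₂, which has k - 1 elements.
  no-core : ∀ {k} (S : Subset n) → S s₁ ≡ true → S s₂ ≡ true → count S ≡ k →
    Stable G (∁ S) → ¬ Core G/ k
  no-core {k} S S₁ S₂ |S| stable (Z , (z , Zz) , dense) =
    1+n≰n (≤-trans (core-size G/ (Z , (z , Zz) , dense)) (≤-trans (count-mono Z⊆S─s₂) small))
    where
    k≡ : k ≡ suc (count (S ─ s₂))
    k≡ = trans (sym |S|) (count-remove S S₂)
    small : count (S ─ s₂) ≤ k
    small = subst (count (S ─ s₂) ≤_) (sym k≡) (n≤1+n _)
    outside : ∀ y → S y ≡ false → adj G/ y ⊆ S ─ s₂
    outside y Sy w e with merged-edge {y} {w} e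
    ... | w≢s₂ , inj₁ yw = ─-intro {P = S} Sw w≢s₂
      where
      Sw : S w ≡ true
      Sw with S w in Sw
      ... | true  = refl
      ... | false = contradiction (stable y w (not-false Sy) (not-false Sw)) (true≢false yw)
    ... | _ , inj₂ (inj₁ refl) = contradiction Sy (true≢false S₁)
    ... | w≢s₂ , inj₂ (inj₂ refl) = ─-intro {P = S} S₁ w≢s₂
    s₂-isolated : count (adj G/ s₂ ∩ Z) ≡ 0
    s₂-isolated = trans (count-cong {Q = λ _ → false} λ u → cong (_∧ Z u) (no-edge u)) (sum-replicate-zero n)
      where
      no-edge : ∀ u → merged s₂ u ≡ false
      no-edge u rewrite ≡ᵇ-refl s₂ = refl
    Z⊆S─s₂ : Z ⊆ S ─ s₂
    Z⊆S─s₂ y Zy with y Fin.≟ s₂ | S y in Sy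
    ... | yes refl | _ = contradiction (subst (k ≤_) s₂-isolated (dense s₂ Zy)) (subst (_≰ 0) (sym k≡) λ ())
    ... | no _ | true = refl
    ... | no _ | false = contradiction
      (≤-trans (dense y Zy) (count-mono λ w e → outside y Sy w (∧-conicalˡ (merged y w) _ e)))
      (subst (_≰ count (S ─ s₂)) (sym k≡) 1+n≰n)

-- If G is not k-colourable, S has k vertices and the vertices outside S are
-- pairwise non-adjacent, then S is a clique (else contract a non-edge in S).
clique-of-uncolourable : ∀ {n} (G : Graph n) {k} → ¬ Colourable G k →
  (S : Subset n) → count S ≡ k → Stable G (∁ S) → Clique G S
clique-of-uncolourable G {k} uncolourable S |S| stable s₁ s₂ s₁≢s₂ S₁ S₂ with adj G s₁ s₂ in e
... | true  = refl
... | false = ⊥-elim (Data.Sum.[ (λ c → uncolourable (lift c)) , no-core S S₁ S₂ |S| stable ]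
                       (colourable-or-core G/ k))
  where open Contraction G s₁ s₂ s₁≢s₂ e

record Complementary {n} (G H : Graph n) : Set where
  field
    adj-one      : ∀ u v → u ≢ v → adj G u v ≡ false → adj H u v ≡ true
    adj-not-both : ∀ u v → adj G u v ≡ true → adj H u v ≡ false
open Complementary public

complementary-sym : ∀ {n} {G H : Graph n} → Complementary G H → Complementary H G
complementary-sym {G = G} {H} GH = record { adj-one = one′ ; adj-not-both = not-both′ }
  where
  one′ : ∀ u v → u ≢ v → adj H u v ≡ false → adj G u v ≡ true
  one′ u v u≢v Huv with adj G u v in Guv
  ... | true  = refl
  ... | false = contradiction Huv (true≢false (adj-one GH u v u≢v Guv))
  not-both′ : ∀ u v → adj H u v ≡ true → adj G u v ≡ false
  not-both′ u v Huv with adj G u v in Guv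
  ... | false = refl
  ... | true  = contradiction (adj-not-both GH u v Guv) (true≢false Huv)

degree-sum : ∀ {n} {G H : Graph n} → Complementary G H → ∀ v →
  suc (count (adj G v) + count (adj H v)) ≡ n
degree-sum {n} {G} {H} GH v = begin
  suc (count (adj G v) + count (adj H v))                          ≡⟨ +-comm 1 _ ⟩
  count (adj G v) + count (adj H v) + 1                            ≡⟨ cong₂ _+_ (∑-distrib-+ bitG bitH) (count-singleton v) ⟨
  ∑[ u < n ] (bitG u + bitH u) + count (_≡ᵇ v)                      ≡⟨ ∑-distrib-+ (λ u → bitG u + bitH u) (λ u → bit (u ≡ᵇ v)) ⟨
  ∑[ u < n ] (bitG u + bitH u + bit (u ≡ᵇ v))                       ≡⟨ sum-cong-≗ exactly-one ⟩
  count {n} (λ _ → true)                                           ≡⟨ count-all n ⟩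
  n                                                                ∎
  where
  open ≡-Reasoning
  bitG bitH : Fin n → ℕ
  bitG u = bit (adj G v u)
  bitH u = bit (adj H v u)
  exactly-one : ∀ u → bitG u + bitH u + bit (u ≡ᵇ v) ≡ 1
  exactly-one u with u Fin.≟ v
  ... | yes refl rewrite adj-irrefl G v | adj-irrefl H v = refl
  ... | no u≢v with adj G v u in Gvu
  ...   | true  rewrite adj-not-both GH v u Gvu = refl
  ...   | false rewrite adj-one GH v u (λ v≡u → u≢v (sym v≡u)) Gvu = refl

exact-degree : ∀ {n} {G H : Graph n} → Complementary G H → ∀ {k₀ k₁} → n ≡ suc (k₀ + k₁) →
  ∀ u → k₀ ≤ count (adj G u) → k₁ ≤ count (adj H u) → count (adj G u) ≡ k₀
exact-degree {G = G} {H} GH {k₀} {k₁} n≡ u k₀≤ k₁≤ =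
  ≤-antisym (≮⇒≥ λ k₀<deg → <⇒≱ (+-mono-<-≤ k₀<deg k₁≤) (≤-reflexive total)) k₀≤
  where
  total : count (adj G u) + count (adj H u) ≡ k₀ + k₁
  total = suc-injective (trans (degree-sum GH u) n≡)

degree-complement : ∀ {n} {G H : Graph n} → Complementary G H → ∀ {k₀ k₁} → n ≡ suc (k₀ + k₁) →
  ∀ u → count (adj H u) ≡ k₁ → count (adj G u) ≡ k₀
degree-complement {G = G} GH {k₀} {k₁} n≡ u degH = +-cancelʳ-≡ k₁ _ _
  (trans (cong (count (adj G u) +_) (sym degH)) (suc-injective (trans (degree-sum GH u) n≡)))

SplitVertex : ∀ {n} → Graph n → ℕ → Fin n → Set
SplitVertex G k v = count (adj G v) ≡ k × Clique G (closedNbhd G v) × Stable G (∁ (closedNbhd G v))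

-- Take a k₀-core X₀ of G and a k₁-core X₁ of H.  They are too large to be
-- disjoint; a shared vertex v has G-degree exactly k₀ and N[v] = X₀.  So X₀
-- has k₀ + 1 vertices of inner degree k₀ and is a clique; the k₁ vertices
-- outside it are stable because H is not k₁-colourable.
module Structure {n} {G H : Graph n} (GH : Complementary G H) {k₀ k₁ : ℕ}
  (n≡ : n ≡ suc (k₀ + k₁)) (G-uncolourable : ¬ Colourable G k₀) (H-uncolourable : ¬ Colourable H k₁)
  (low-clique : ∀ u v → u ≢ v → count (adj G u) ≡ k₀ → count (adj G v) ≡ k₀ → adj G u v ≡ true)
  where

  C₀ : Core G k₀
  C₀ = core-of-uncolourable G G-uncolourable
  C₁ : Core H k₁
  C₁ = core-of-uncolourable H H-uncolourable

  X₀ X₁ : Subset n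
  X₀ = proj₁ C₀
  X₁ = proj₁ C₁

  -- The cores have at least k₀ + 1 and k₁ + 1 = n - k₀ vertices, so they meet.
  shared : Σ (Fin n) λ v → (X₀ ∩ X₁) v ≡ true
  shared = count-nonempty (+-cancelˡ-≤ n 1 _
    (subst (_≤ n + count (X₀ ∩ X₁)) sizes
      (≤-trans (+-mono-≤ (core-size G C₀) (core-size H C₁)) (count-∩ X₀ X₁))))
    where
    sizes : suc k₀ + suc k₁ ≡ n + 1
    sizes = trans (cong suc (+-suc k₀ k₁)) (trans (cong suc (sym n≡)) (+-comm 1 n))

  module Shared (u : Fin n) (u₀ : X₀ u ≡ true) (u₁ : X₁ u ≡ true) where
    G-low : k₀ ≤ count (adj G u)
    G-low = ≤-trans (proj₂ (proj₂ C₀) u u₀) (count-mono λ w e → ∧-conicalˡ (adj G u w) _ e)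
    H-low : k₁ ≤ count (adj H u)
    H-low = ≤-trans (proj₂ (proj₂ C₁) u u₁) (count-mono λ w e → ∧-conicalˡ (adj H u w) _ e)
    degG : count (adj G u) ≡ k₀
    degG = exact-degree GH n≡ u G-low H-low
    degH : count (adj H u) ≡ k₁
    degH = exact-degree (complementary-sym GH) (trans n≡ (cong suc (+-comm k₀ k₁))) u H-low G-low
    nbhdG : adj G u ⊆ X₀
    nbhdG = nbhd-inside G (proj₂ (proj₂ C₀)) u₀ degG
    nbhdH : adj H u ⊆ X₁
    nbhdH = nbhd-inside H (proj₂ (proj₂ C₁)) u₁ degH

  v : Fin n
  v = proj₁ shared
  v₀ : X₀ v ≡ true
  v₀ = ∧-conicalˡ (X₀ v) _ (proj₂ shared)
  module V = Shared v v₀ (∧-conicalʳ (X₀ v) _ (proj₂ shared))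

  N[v] : Subset n
  N[v] = closedNbhd G v

  N[v]⊆X₀ : N[v] ⊆ X₀
  N[v]⊆X₀ u e with ∨-true {u ≡ᵇ v} e
  ... | inj₁ u≡ᵇv = subst (λ w → X₀ w ≡ true) (sym (≡ᵇ-sound u≡ᵇv)) v₀
  ... | inj₂ vu = V.nbhdG u vu

  -- A vertex of X₀ not adjacent to v would be an H-neighbour of v, hence
  -- shared, hence of degree k₀ and so adjacent to v after all.
  X₀⊆N[v] : X₀ ⊆ N[v]
  X₀⊆N[v] u u₀ with u Fin.≟ v
  ... | yes refl = refl
  ... | no u≢v with adj G v u in Gvu
  ...   | true  = refl
  ...   | false = ⊥-elim (true≢false (trans (adj-sym G v u) (low-clique u v u≢v U.degG V.degG)) Gvu)
    where
    module U = Shared u u₀ (V.nbhdH u (adj-one GH v u (λ v≡u → u≢v (sym v≡u)) Gvu))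

  |N[v]| : count N[v] ≡ suc k₀
  |N[v]| = trans (count-closedNbhd G v) (cong suc V.degG)

  -- Hence X₀ = N[v] has k₀ + 1 vertices, each with k₀ neighbours inside: a clique.
  |X₀| : count X₀ ≡ suc k₀
  |X₀| = ≤-antisym (subst (count X₀ ≤_) |N[v]| (count-mono X₀⊆N[v])) (core-size G C₀)

  clique : Clique G N[v]
  clique x y x≢y Nx Ny =
    tight-set-is-clique G (proj₂ (proj₂ C₀)) |X₀| x y x≢y (N[v]⊆X₀ x Nx) (N[v]⊆X₀ y Ny)

  -- The k₁ vertices outside N[v] have an H-stable complement, so they form an
  -- H-clique, i.e. a G-stable set.
  |∁N[v]| : count (∁ N[v]) ≡ k₁
  |∁N[v]| = +-cancelˡ-≡ (suc k₀) _ _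
    (trans (cong (_+ count (∁ N[v])) (sym |N[v]|)) (trans (count-∁ N[v]) n≡))

  H-clique : Clique H (∁ N[v])
  H-clique = clique-of-uncolourable H H-uncolourable (∁ N[v]) |∁N[v]| H-stable
    where
    H-stable : Stable H (∁ (∁ N[v]))
    H-stable x y Nx Ny with x Fin.≟ y
    ... | yes refl = adj-irrefl H x
    ... | no x≢y = adj-not-both GH x y (clique x y x≢y
            (trans (sym (BoolP.not-involutive (N[v] x))) Nx) (trans (sym (BoolP.not-involutive (N[v] y))) Ny))

  stable : Stable G (∁ N[v])
  stable x y Sx Sy with x Fin.≟ y
  ... | yes refl = adj-irrefl G x
  ... | no x≢y = adj-not-both (complementary-sym GH) x y (H-clique x y x≢y Sx Sy)

  split : Σ (Fin n) (SplitVertex G k₀)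
  split = v , V.degG , clique , stable

-- Splitting is self-complementary: if v splits H at degree k₁ then it splits
-- G at degree k₀, since N_G[v] = {v} ∪ (V ∖ N_H[v]) and V ∖ N_G[v] = N_H(v).
split-complement : ∀ {n} {G H : Graph n} → Complementary G H → ∀ {k₀ k₁} → n ≡ suc (k₀ + k₁) →
  ∀ {v} → SplitVertex H k₁ v → SplitVertex G k₀ v
split-complement {G = G} {H} GH {k₀} {k₁} n≡ {v} (degH , H-clique , H-stable) = degG , clique , stable
  where
  HG = complementary-sym GH
  degG : count (adj G v) ≡ k₀
  degG = degree-complement GH n≡ v degH
  G-nbr-outside : ∀ {x} → x ≢ v → adj G v x ≡ true → not (closedNbhd H v x) ≡ true
  G-nbr-outside {x} x≢v e rewrite ≡ᵇ-≢ x≢v | adj-not-both GH v x e = refl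
  clique : Clique G (closedNbhd G v)
  clique x y x≢y Nx Ny with x Fin.≟ v | y Fin.≟ v
  ... | yes refl | yes refl = contradiction refl x≢y
  ... | yes refl | no y≢v = Ny
  ... | no x≢v | yes refl = trans (adj-sym G x v) Nx
  ... | no x≢v | no y≢v = adj-one HG x y x≢y (H-stable x y (G-nbr-outside x≢v Nx) (G-nbr-outside y≢v Ny))
  outside-G-in-H : ∀ {x} → not (closedNbhd G v x) ≡ true → closedNbhd H v x ≡ true
  outside-G-in-H {x} e with outside-closedNbhd G {v} {x} (not-true e)
  ... | x≢v , Gvx rewrite ≡ᵇ-≢ x≢v = adj-one GH v x (λ v≡x → x≢v (sym v≡x)) Gvx
  stable : Stable G (∁ (closedNbhd G v))
  stable x y Sx Sy with x Fin.≟ y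
  ... | yes refl = adj-irrefl G x
  ... | no x≢y = adj-not-both HG x y (H-clique x y x≢y (outside-G-in-H Sx) (outside-G-in-H Sy))

≤ᵇ-true : ∀ {x y} → x ≤ y → (x ≤ᵇ y) ≡ true
≤ᵇ-true x≤y = Equivalence.to T-≡ (≤⇒≤ᵇ x≤y)

≤ᵇ-sound : ∀ {x y} → (x ≤ᵇ y) ≡ true → x ≤ y
≤ᵇ-sound {x} {y} e = ≤ᵇ⇒≤ x y (Equivalence.from T-≡ e)

≤ᵇ-false : ∀ {x y} → x ≰ y → (x ≤ᵇ y) ≡ false
≤ᵇ-false {x} {y} x≰y with x ≤ᵇ y in e
... | false = refl
... | true  = contradiction (≤ᵇ-sound e) x≰y

<ᵇ-true : ∀ {x y} → x < y → (x <ᵇ y) ≡ true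
<ᵇ-true = ≤ᵇ-true

<ᵇ-sound : ∀ {x y} → (x <ᵇ y) ≡ true → x < y
<ᵇ-sound = ≤ᵇ-sound

<ᵇ-false : ∀ {x y} → ¬ x < y → (x <ᵇ y) ≡ false
<ᵇ-false = ≤ᵇ-false

module NonIncreasing {n} (d : Fin n → ℕ) (sorted : ∀ (i j : Fin n) → toℕ i ≤ toℕ j → d j ≤ d i)
  (t c : ℕ) (|≥t| : count (λ i → t ≤ᵇ d i) ≡ c) where

  large⇒early : ∀ i → t ≤ d i → toℕ i < c
  large⇒early i t≤di = ≰⇒> λ c≤i → <⇒≱ (s≤s c≤i)
    (subst₂ _≤_ (count-Prefix (suc (toℕ i)) (toℕ<n i)) |≥t| (count-mono earlier-large))
    where
    earlier-large : Prefix (suc (toℕ i)) ⊆ (λ j → t ≤ᵇ d j)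
    earlier-large j j≤i = ≤ᵇ-true (≤-trans t≤di (sorted j i (s≤s⁻¹ (<ᵇ-sound j≤i))))

  early⇒large : ∀ i → toℕ i < c → t ≤ d i
  early⇒large i i<c with t ≤? d i
  ... | yes t≤di = t≤di
  ... | no t≰di = contradiction
    (subst₂ _≤_ |≥t| (count-Prefix (toℕ i) (<⇒≤ (toℕ<n i))) (count-mono large-earlier)) (<⇒≱ i<c)
    where
    large-earlier : (λ j → t ≤ᵇ d j) ⊆ Prefix (toℕ i)
    large-earlier j t≤dj = <ᵇ-true (≰⇒> λ i≤j → t≰di (≤-trans (≤ᵇ-sound t≤dj) (sorted i j i≤j)))

-- Double counting of edges between a set X of size m and its complement,
-- in a graph whose degrees are d.
module DoubleCounting {n} (G : Graph n) (d : Fin n → ℕ) (degree : ∀ i → d i ≡ count (adj G i))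
  (X : Subset n) (m : ℕ) (|X| : count X ≡ m) where

  Y : Subset n
  Y = ∁ X

  degSum : Subset n → ℕ
  degSum P = ∑[ i < n ] (if P i then d i else 0)

  -- The number of ordered edges from P to Q.
  edges : Subset n → Subset n → ℕ
  edges P Q = ∑[ i < n ] ∑[ j < n ] bit (P i ∧ (adj G i j ∧ Q j))

  degSum-split : ∀ P → degSum P ≡ edges P X + edges P Y
  degSum-split P = trans (sum-cong-≗ row) (∑-distrib-+ (λ i → ∑[ j < n ] bit (P i ∧ (adj G i j ∧ X j)))
                                                         (λ i → ∑[ j < n ] bit (P i ∧ (adj G i j ∧ Y j))))
    where
    row : ∀ i → (if P i then d i else 0) ≡
      ∑[ j < n ] bit (P i ∧ (adj G i j ∧ X j)) + ∑[ j < n ] bit (P i ∧ (adj G i j ∧ Y j))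
    row i with P i
    ... | true = trans (degree i) (trans (sum-cong-≗ side) (∑-distrib-+ (λ j → bit (adj G i j ∧ X j)) (λ j → bit (adj G i j ∧ Y j))))
      where
      side : ∀ j → bit (adj G i j) ≡ bit (adj G i j ∧ X j) + bit (adj G i j ∧ Y j)
      side j with adj G i j | X j
      ... | true  | true  = refl
      ... | true  | false = refl
      ... | false | _     = refl
    ... | false = sym (cong₂ _+_ (sum-replicate-zero n) (sum-replicate-zero n))

  edges-sym : ∀ P Q → edges P Q ≡ edges Q P
  edges-sym P Q = trans (∑-comm (λ i j → bit (P i ∧ (adj G i j ∧ Q j))))
                        (sum-cong-≗ λ i → sum-cong-≗ λ j → flip-edge i j)
    where
    flip-edge : ∀ i j → bit (P j ∧ (adj G j i ∧ Q i)) ≡ bit (Q i ∧ (adj G i j ∧ P j))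
    flip-edge i j rewrite adj-sym G j i with P j | Q i
    ... | true  | true  = refl
    ... | true  | false = cong bit (∧-zeroʳ (adj G i j))
    ... | false | true  = cong bit (sym (∧-zeroʳ (adj G i j)))
    ... | false | false = refl

  row : Fin n → ℕ
  row i = ∑[ j < n ] bit (X i ∧ (adj G i j ∧ X j))

  row-member : ∀ {i} → X i ≡ true → row i ≡ count (adj G i ∩ X)
  row-member Xi rewrite Xi = refl

  |X─i| : ∀ {i} → X i ≡ true → count (X ─ i) ≡ m ∸ 1
  |X─i| Xi = cong (_∸ 1) (trans (sym (count-remove X Xi)) |X|)

  row-bound : ∀ i → row i ≤ bit (X i) * (m ∸ 1)
  row-bound i with X i in Xi
  ... | false = ≤-reflexive (sum-replicate-zero n)
  ... | true  = subst (count (adj G i ∩ X) ≤_) (trans (|X─i| Xi) (sym (+-identityʳ (m ∸ 1))))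
                  (count-mono (nbhd∩⊆─ G X i))

  row-bounds-sum : ∑[ i < n ] (bit (X i) * (m ∸ 1)) ≡ m * (m ∸ 1)
  row-bounds-sum = trans (sym (*-distribʳ-sum (m ∸ 1) (λ i → bit (X i)))) (cong (_* (m ∸ 1)) |X|)

  edges-XX≤ : edges X X ≤ m * (m ∸ 1)
  edges-XX≤ = subst (edges X X ≤_) row-bounds-sum (sum-mono row-bound)

  edges-XX⇒clique : edges X X ≡ m * (m ∸ 1) → Clique G X
  edges-XX⇒clique full x y x≢y Xx Xy =
    ∧-conicalˡ (adj G x y) _
      (count-⊆-eq (nbhd∩⊆─ G X x) (≤-reflexive (trans (|X─i| Xx) (sym full-row))) y
        (─-intro {P = X} Xy λ y≡x → x≢y (sym y≡x)))
    where
    row-x : row x ≡ bit (X x) * (m ∸ 1)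
    row-x = sum-rigid row-bound (≤-reflexive (trans row-bounds-sum (sym full))) x
    full-row : count (adj G x ∩ X) ≡ m ∸ 1
    full-row = trans (sym (row-member Xx))
      (trans row-x (trans (cong (λ b → bit b * (m ∸ 1)) Xx) (+-identityʳ (m ∸ 1))))

  clique⇒edges-XX : Clique G X → edges X X ≡ m * (m ∸ 1)
  clique⇒edges-XX clique = trans (sum-cong-≗ full) row-bounds-sum
    where
    full : ∀ i → row i ≡ bit (X i) * (m ∸ 1)
    full i with X i in Xi
    ... | false = sum-replicate-zero n
    ... | true  = trans (count-cong same) (trans (|X─i| Xi) (sym (+-identityʳ (m ∸ 1))))
      where
      same : ∀ j → (adj G i ∩ X) j ≡ (X ─ i) j
      same j with j Fin.≟ i
      ... | yes refl rewrite adj-irrefl G i = sym (∧-zeroʳ (X i))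
      ... | no j≢i with X j in Xj
      ...   | false = ∧-zeroʳ (adj G i j)
      ...   | true rewrite clique i j (λ i≡j → j≢i (sym i≡j)) Xi Xj = refl

  edges-YY⇒stable : edges Y Y ≡ 0 → Stable G Y
  edges-YY⇒stable none x y Yx Yy with adj G x y in xy
  ... | false = refl
  ... | true  = contradiction (trans (sym counted) uncounted) λ ()
    where
    counted : bit (Y x ∧ (adj G x y ∧ Y y)) ≡ 1
    counted rewrite Yx | xy | Yy = refl
    uncounted : bit (Y x ∧ (adj G x y ∧ Y y)) ≡ 0
    uncounted = sum-zero (λ j → bit (Y x ∧ (adj G x j ∧ Y j)))
      (sum-zero (λ i → ∑[ j < n ] bit (Y i ∧ (adj G i j ∧ Y j))) none x) y

  stable⇒edges-YY : Stable G Y → edges Y Y ≡ 0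
  stable⇒edges-YY stable =
    trans (sum-cong-≗ λ i → trans (sum-cong-≗ (no-edge i)) (sum-replicate-zero n)) (sum-replicate-zero n)
    where
    no-edge : ∀ i j → bit (Y i ∧ (adj G i j ∧ Y j)) ≡ 0
    no-edge i j with Y i in Yi | Y j in Yj
    ... | false | _     = refl
    ... | true  | false rewrite ∧-zeroʳ (adj G i j) = refl
    ... | true  | true  rewrite stable i j Yi Yj = refl

  -- degSum X = e(X,X) + e(X,Y) and degSum Y = e(Y,X) + e(Y,Y) with
  -- e(X,Y) = e(Y,X), so the condition says e(X,X) = m (m - 1) + e(Y,Y);
  -- as e(X,X) ≤ m (m - 1), this forces e(X,X) = m (m - 1) and e(Y,Y) = 0.
  condition⇒clique-stable : degSum X ≡ m * (m ∸ 1) + degSum Y → Clique G X × Stable G Y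
  condition⇒clique-stable condition = edges-XX⇒clique full , edges-YY⇒stable none
    where
    M = m * (m ∸ 1)
    shifted : edges X X + edges X Y ≡ (M + edges Y Y) + edges X Y
    shifted = begin
      edges X X + edges X Y              ≡⟨ degSum-split X ⟨
      degSum X                           ≡⟨ condition ⟩
      M + degSum Y                       ≡⟨ cong (M +_) (degSum-split Y) ⟩
      M + (edges Y X + edges Y Y)        ≡⟨ cong (λ e → M + (e + edges Y Y)) (edges-sym Y X) ⟩
      M + (edges X Y + edges Y Y)        ≡⟨ cong (M +_) (+-comm (edges X Y) (edges Y Y)) ⟩
      M + (edges Y Y + edges X Y)        ≡⟨ +-assoc M _ _ ⟨
      (M + edges Y Y) + edges X Y        ∎
      where open ≡-Reasoning
    XX≡ : edges X X ≡ M + edges Y Y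
    XX≡ = +-cancelʳ-≡ (edges X Y) _ _ shifted
    none : edges Y Y ≡ 0
    none = n≤0⇒n≡0 (+-cancelˡ-≤ M _ _ (subst (_≤ M + 0) XX≡ (subst (edges X X ≤_) (sym (+-identityʳ M)) edges-XX≤)))
    full : edges X X ≡ M
    full = trans XX≡ (trans (cong (M +_) none) (+-identityʳ M))

  clique-stable⇒condition : Clique G X → Stable G Y → degSum X ≡ m * (m ∸ 1) + degSum Y
  clique-stable⇒condition clique stable = begin
    degSum X                           ≡⟨ degSum-split X ⟩
    edges X X + edges X Y              ≡⟨ cong₂ _+_ (clique⇒edges-XX clique) (edges-sym X Y) ⟩
    m * (m ∸ 1) + edges Y X            ≡⟨ cong (m * (m ∸ 1) +_) (+-identityʳ (edges Y X)) ⟨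
    m * (m ∸ 1) + (edges Y X + 0)      ≡⟨ cong (λ e → m * (m ∸ 1) + (edges Y X + e)) (stable⇒edges-YY stable) ⟨
    m * (m ∸ 1) + (edges Y X + edges Y Y) ≡⟨ cong (m * (m ∸ 1) +_) (degSum-split Y) ⟨
    m * (m ∸ 1) + degSum Y             ∎
    where open ≡-Reasoning

sum-take : ∀ {n} (f : Fin n → ℕ) m →
  ListAction.sum (take m (toList f)) ≡ ∑[ i < n ] (if Prefix m i then f i else 0)
sum-take {zero}  f zero    = refl
sum-take {zero}  f (suc m) = refl
sum-take {suc n} f zero    = sym (sum-replicate-zero (suc n))
sum-take {suc n} f (suc m) = cong (f fzero +_) (sum-take (f ∘ fsuc) m)

sum-drop : ∀ {n} (f : Fin n → ℕ) m →
  ListAction.sum (drop m (toList f)) ≡ ∑[ i < n ] (if ∁ (Prefix m) i then f i else 0)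
sum-drop {zero}  f zero    = refl
sum-drop {zero}  f (suc m) = refl
sum-drop {suc n} f zero    = sum-toList f
sum-drop {suc n} f (suc m) = sum-drop (f ∘ fsuc) m

module SortedGraph {n} {G H : Graph n} (GH : Complementary G H) (d : Fin n → ℕ)
  (degree : ∀ i → d i ≡ count (adj G i))
  (sorted : ∀ (i j : Fin n) → toℕ i ≤ toℕ j → d j ≤ d i) (m : ℕ) (isM : IsM d m) where

  DegreeCondition : Set
  DegreeCondition = (sumUpTo d m ≡ m * (m ∸ 1) + sumFrom d m) × DmIs d m

  -- The vertices of degree k - 1 (part A when χ(G) = k) form a clique / a stable set.
  LowClique LowStable : ℕ → Set
  LowClique k = ∀ u v → u ≢ v → d u ≡ k ∸ 1 → d v ≡ k ∸ 1 → adj G u v ≡ true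
  LowStable k = ∀ u v → d u ≡ k ∸ 1 → d v ≡ k ∸ 1 → adj G u v ≡ false

  X : Subset n
  X = Prefix m

  -- w is the m-th vertex (index m - 1).
  w : Fin n
  w = proj₁ (proj₁ isM)
  w-pos : suc (toℕ w) ≡ m
  w-pos = proj₁ (proj₂ (proj₁ isM))
  w-large : toℕ w ≤ d w
  w-large = proj₂ (proj₂ (proj₁ isM))

  m≤n : m ≤ n
  m≤n = subst (_≤ n) w-pos (toℕ<n w)

  |X| : count X ≡ m
  |X| = count-Prefix m m≤n

  open DoubleCounting G d degree X m |X| public

  |Y| : count Y ≡ n ∸ m
  |Y| = trans (sym (m+n∸m≡n m (count Y))) (cong (_∸ m) (trans (cong (_+ count Y) (sym |X|)) (count-∁ X)))

  condition : Clique G X → Stable G Y → d w ≡ m ∸ 1 → DegreeCondition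
  condition clique stable dw = sums , last
    where
    sums : sumUpTo d m ≡ m * (m ∸ 1) + sumFrom d m
    sums = trans (sum-take d m)
      (trans (clique-stable⇒condition clique stable) (cong (m * (m ∸ 1) +_) (sym (sum-drop d m))))
    last : DmIs d m
    last i i-pos = trans (cong d (toℕ-injective (suc-injective (trans i-pos (sym w-pos))))) dw

  condition⇒split : DegreeCondition → Clique G X × Stable G Y
  condition⇒split (sums , _) = condition⇒clique-stable
    (trans (sym (sum-take d m)) (trans sums (cong (m * (m ∸ 1) +_) (sum-drop d m))))

  module FromCondition (clique : Clique G X) (stable : Stable G Y) (dw : d w ≡ m ∸ 1) where

    saturated : ∀ p → X p ≡ true → d p ≡ m ∸ 1 → adj G p ⊆ X
    saturated p Xp dp s ps = ∧-conicalˡ (X s) _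
      (count-⊆-eq {P = X ─ p} {Q = adj G p} X─p⊆nbhd
        (≤-reflexive (trans (sym (degree p)) (trans dp (sym (|X─i| Xp))))) s ps)
      where
      X─p⊆nbhd : X ─ p ⊆ adj G p
      X─p⊆nbhd u e with ─-elim {P = X} e
      ... | Xu , u≢p = clique p u (λ p≡u → u≢p (sym p≡u)) Xp Xu

    -- Vertices after position m have degree below m, by the maximality of m.
    outside-small : ∀ s → X s ≡ false → d s < m
    outside-small s Xs = ≤-<-trans (sorted jm s (subst (_≤ toℕ s) (sym (toℕ-fromℕ< m<n)) m≤s))
      (subst (d jm <_) (toℕ-fromℕ< m<n) (proj₂ isM jm (subst (λ z → m < suc z) (sym (toℕ-fromℕ< m<n)) ≤-refl)))
      where
      m≤s : m ≤ toℕ s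
      m≤s = ≮⇒≥ (λ s<m → true≢false (<ᵇ-true s<m) Xs)
      m<n : m < n
      m<n = ≤-<-trans m≤s (toℕ<n s)
      jm : Fin n
      jm = fromℕ< m<n

    G-chromatic : IsChromatic G m
    G-chromatic = colourable-outside-small G X (≤-reflexive |X|)
                    (λ x Xx → subst (_< m) (degree x) (outside-small x Xx))
                , clique-needs-colours G g (λ i j i<j → clique (g i) (g j) (g-distinct i<j) (g-in i) (g-in j))
      where
      g : Fin m → Fin n
      g t = inject≤ t m≤n
      g-in : ∀ t → X (g t) ≡ true
      g-in t = <ᵇ-true (subst (_< m) (sym (toℕ-inject≤ t m≤n)) (toℕ<n t))
      g-distinct : ∀ {i j} → toℕ i < toℕ j → g i ≢ g j
      g-distinct {i} {j} i<j eq = <-irrefl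
        (trans (sym (toℕ-inject≤ i m≤n)) (trans (cong toℕ eq) (toℕ-inject≤ j m≤n))) i<j

    k′ : ℕ
    k′ = suc (n ∸ m)

    sizes : m + k′ ≡ n + 1
    sizes = trans (+-suc m (n ∸ m)) (trans (cong suc (m+[n∸m]≡n m≤n)) (+-comm 1 n))

    -- X is a G-clique, so the H-neighbours of a vertex of X lie in Y.
    H-nbrs : ∀ p → X p ≡ true → adj H p ⊆ Y
    H-nbrs p Xp u Hpu with X u in Xu
    ... | false = refl
    ... | true  = ⊥-elim (true≢false Hpu (adj-not-both GH p u (clique p u p≢u Xp Xu)))
      where
      p≢u : p ≢ u
      p≢u refl = true≢false Hpu (adj-irrefl H p)

    -- The vertices w, w + 1, …, n - 1 are pairwise H-adjacent: beyond w
    -- everything is in the stable set Y, and w is saturated inside X.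
    tail-edge : ∀ x y → toℕ w ≤ toℕ x → toℕ x < toℕ y → adj H x y ≡ true
    tail-edge x y w≤x x<y = adj-one GH x y (λ { refl → <-irrefl refl x<y }) non-adjacent
      where
      Xy : X y ≡ false
      Xy = <ᵇ-false λ y<m → <-irrefl refl (≤-trans y<m (subst (_≤ toℕ y) w-pos (≤-trans (s≤s w≤x) x<y)))
      non-adjacent : adj G x y ≡ false
      non-adjacent with x Fin.≟ w
      ... | yes refl with adj G w y in wy
      ...   | false = refl
      ...   | true  = ⊥-elim (true≢false (saturated w (<ᵇ-true (≤-reflexive w-pos)) dw y wy) Xy)
      non-adjacent | no x≢w = stable x y
        (not-false (<ᵇ-false λ x<m → x≢w (toℕ-injective (≤-antisym (s≤s⁻¹ (subst (toℕ x <_) (sym w-pos) x<m)) w≤x))))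
        (not-false Xy)

    H-chromatic : IsChromatic H k′
    H-chromatic = colourable-outside-small H Y (subst (_≤ k′) (sym |Y|) (n≤1+n _))
                    (λ x Yx → s≤s (subst (count (adj H x) ≤_) |Y| (count-mono (H-nbrs x (not≡false Yx)))))
                , clique-needs-colours H g (λ i j i<j → tail-edge (g i) (g j) (w≤g i) (g-mono i<j))
      where
      bound : ∀ (t : Fin k′) → toℕ w + toℕ t < n
      bound t = ≤-trans (s≤s (+-monoʳ-≤ (toℕ w) (s≤s⁻¹ (toℕ<n t))))
                        (≤-reflexive (trans (cong (_+ (n ∸ m)) w-pos) (m+[n∸m]≡n m≤n)))
      g : Fin k′ → Fin n
      g t = fromℕ< (bound t)
      w≤g : ∀ t → toℕ w ≤ toℕ (g t)
      w≤g t = subst (toℕ w ≤_) (sym (toℕ-fromℕ< (bound t))) (m≤m+n (toℕ w) (toℕ t))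
      g-mono : ∀ {i j} → toℕ i < toℕ j → toℕ (g i) < toℕ (g j)
      g-mono {i} {j} i<j = subst₂ _<_ (sym (toℕ-fromℕ< (bound i))) (sym (toℕ-fromℕ< (bound j)))
                             (+-monoʳ-< (toℕ w) i<j)

    -- If a vertex s₀ outside X has degree m - 1, two adjacent vertices of X
    -- of degree m - 1 are impossible: s₀'s neighbours would lie in X minus both.
    low-stable : ∀ s₀ → X s₀ ≡ false → d s₀ ≡ m ∸ 1 → LowStable m
    low-stable s₀ Xs₀ ds₀ u v du dv with adj G u v in uv
    ... | false = refl
    ... | true with X u in Xu | X v in Xv
    ...   | false | false = ⊥-elim (true≢false uv (stable u v (not-false Xu) (not-false Xv)))
    ...   | true  | false = ⊥-elim (true≢false (saturated u Xu du v uv) Xv)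
    ...   | false | true  = ⊥-elim (true≢false (saturated v Xv dv u (trans (adj-sym G v u) uv)) Xu)
    ...   | true  | true  = ⊥-elim (1+n≰n (subst (_≤ count ((X ─ u) ─ v)) (trans (sym (degree s₀)) (trans ds₀ m-1≡)) (count-mono nbrs)))
      where
      u≢v : u ≢ v
      u≢v refl = true≢false uv (adj-irrefl G u)
      m-1≡ : m ∸ 1 ≡ suc (count ((X ─ u) ─ v))
      m-1≡ = cong (_∸ 1) (trans (sym |X|) (trans (count-remove X Xu)
               (cong suc (count-remove (X ─ u) (─-intro {P = X} Xv (λ v≡u → u≢v (sym v≡u)))))))
      not-nbr : ∀ p → X p ≡ true → d p ≡ m ∸ 1 → ∀ y → adj G s₀ y ≡ true → y ≢ p
      not-nbr p Xp dp y s₀y refl = true≢false (saturated p Xp dp s₀ (trans (adj-sym G p s₀) s₀y)) Xs₀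
      in-X : ∀ y → adj G s₀ y ≡ true → X y ≡ true
      in-X y s₀y with X y in Xy
      ... | true  = refl
      ... | false = ⊥-elim (true≢false s₀y (stable s₀ y (not-false Xs₀) (not-false Xy)))
      nbrs : adj G s₀ ⊆ (X ─ u) ─ v
      nbrs y s₀y = ─-intro {P = X ─ u} (─-intro {P = X} (in-X y s₀y) (not-nbr u Xu du y s₀y)) (not-nbr v Xv dv y s₀y)

    low-clique-or-stable : LowClique m ⊎ LowStable m
    low-clique-or-stable with any? (λ s → (X s BoolP.≟ false) ×-dec (d s ≟ m ∸ 1))
    ... | yes (s₀ , Xs₀ , ds₀) = inj₂ (low-stable s₀ Xs₀ ds₀)
    ... | no none = inj₁ λ u v u≢v du dv → clique u v u≢v (low-in-X u du) (low-in-X v dv)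
      where
      low-in-X : ∀ u → d u ≡ m ∸ 1 → X u ≡ true
      low-in-X u du with X u in Xu
      ... | true  = refl
      ... | false = contradiction (u , Xu , du) none

  -- The forward direction, last step: a vertex v splitting G at degree k₀
  -- together with the hypothesis on part A pins down the first k₀ + 1
  -- vertices of the sorted order, and m = k₀ + 1.
  module FromSplit (k₀ : ℕ) (v : Fin n) (split : SplitVertex G k₀ v) where

    K : Subset n
    K = closedNbhd G v

    dv : d v ≡ k₀
    dv = trans (degree v) (proj₁ split)

    |K| : count K ≡ suc k₀
    |K| = trans (count-closedNbhd G v) (cong suc (proj₁ split))

    k₀<n : k₀ < n
    k₀<n = subst (_≤ n) |K| (count-≤ K)

    nbr-in-K : ∀ {x} → adj G v x ≡ true → K x ≡ true
    nbr-in-K {x} e = trans (cong ((x ≡ᵇ v) ∨_) e) (∨-zeroʳ (x ≡ᵇ v))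

    outside-K : ∀ {x} → x ≢ v → adj G v x ≡ false → K x ≡ false
    outside-K {x} x≢v vx = trans (cong (_∨ adj G v x) (≡ᵇ-≢ x≢v)) vx

    K-large : ∀ x → K x ≡ true → k₀ ≤ d x
    K-large x Kx = subst (k₀ ≤_) (sym (degree x))
      (subst (_≤ count (adj G x)) (suc-injective (trans (sym (count-remove K Kx)) |K|))
        (count-mono λ y e → proj₁ (proj₂ split) x y (λ x≡y → proj₂ (─-elim {P = K} e) (sym x≡y))
                              Kx (proj₁ (─-elim {P = K} e))))

    outside-nbrs : ∀ x → K x ≡ false → adj G x ⊆ adj G v
    outside-nbrs x Kx y xy = closedNbhd-other G y≢v Ky
      where
      Ky : K y ≡ true
      Ky with K y in Ky
      ... | true  = refl
      ... | false = ⊥-elim (true≢false xy (proj₂ (proj₂ split) x y (not-false Kx) (not-false Ky)))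
      y≢v : y ≢ v
      y≢v refl = true≢false (trans (adj-sym G v x) xy) (proj₂ (outside-closedNbhd G Kx))

    outside-small : ∀ x → K x ≡ false → d x ≤ k₀
    outside-small x Kx = subst (_≤ k₀) (sym (degree x))
      (subst (count (adj G x) ≤_) (proj₁ split) (count-mono (outside-nbrs x Kx)))

    jw : Fin n
    jw = fromℕ< k₀<n
    jw-pos : toℕ jw ≡ k₀
    jw-pos = toℕ-fromℕ< k₀<n

    m-from : k₀ ≤ d jw → (∀ i → suc k₀ ≤ toℕ i → d i ≤ k₀) → m ≡ suc k₀
    m-from k₀≤djw later-small = ≤-antisym m≤ ≥m
      where
      m≤ : m ≤ suc k₀
      m≤ = ≮⇒≥ λ k₀<m → let k₀<w = s≤s⁻¹ (subst (suc (suc k₀) ≤_) (sym w-pos) k₀<m) in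
        1+n≰n (≤-trans k₀<w (≤-trans w-large (later-small w k₀<w)))
      ≥m : suc k₀ ≤ m
      ≥m = ≮⇒≥ λ m<k₀+1 → <⇒≱ (subst (d jw <_) jw-pos
             (proj₂ isM jw (subst (λ z → m < suc z) (sym jw-pos) m<k₀+1))) k₀≤djw

    finish : m ≡ suc k₀ → Clique G X → Stable G Y → d jw ≡ k₀ → DegreeCondition
    finish m≡ clique stable djw =
      condition clique stable (trans (cong d w≡jw) (trans djw (cong (_∸ 1) (sym m≡))))
      where
      w≡jw : w ≡ jw
      w≡jw = toℕ-injective (trans (suc-injective (trans w-pos m≡)) (sym jw-pos))

    -- Part A a clique: then every vertex outside K has degree < k₀, so K
    -- consists exactly of the first k₀ + 1 vertices.
    module WithLowClique (low-clique : LowClique (suc k₀)) where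

      outside-smaller : ∀ x → K x ≡ false → d x < k₀
      outside-smaller x Kx = ≤∧≢⇒< (outside-small x Kx) λ dx →
        true≢false (trans (adj-sym G v x) (low-clique x v (proj₁ (outside-closedNbhd G Kx)) dx dv))
                   (proj₂ (outside-closedNbhd G Kx))

      threshold : count (λ i → k₀ ≤ᵇ d i) ≡ suc k₀
      threshold = trans (count-cong same) |K|
        where
        same : ∀ i → (k₀ ≤ᵇ d i) ≡ K i
        same i with K i in Ki
        ... | true  = ≤ᵇ-true (K-large i Ki)
        ... | false = ≤ᵇ-false (<⇒≱ (outside-smaller i Ki))

      open NonIncreasing d sorted k₀ (suc k₀) threshold

      early-K : ∀ i → toℕ i < suc k₀ → K i ≡ true
      early-K i early with K i in Ki
      ... | true  = refl
      ... | false = ⊥-elim (<⇒≱ (outside-smaller i Ki) (early⇒large i early))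

      jw∈K : K jw ≡ true
      jw∈K = early-K jw (s≤s (≤-reflexive jw-pos))

      m≡ : m ≡ suc k₀
      m≡ = m-from (K-large jw jw∈K) λ i late → <⇒≤ (outside-smaller i (late-outside i late))
        where
        late-outside : ∀ i → suc k₀ ≤ toℕ i → K i ≡ false
        late-outside i late with K i in Ki
        ... | false = refl
        ... | true  = ⊥-elim (<⇒≱ (large⇒early i (K-large i Ki)) late)

      X≗K : ∀ i → X i ≡ K i
      X≗K i with K i in Ki
      ... | true  = <ᵇ-true (subst (toℕ i <_) (sym m≡) (large⇒early i (K-large i Ki)))
      ... | false = <ᵇ-false λ i<m → true≢false (early-K i (subst (toℕ i <_) m≡ i<m)) Ki

      result : DegreeCondition
      result = finish m≡
        (λ x y x≢y Xx Xy → proj₁ (proj₂ split) x y x≢y (trans (sym (X≗K x)) Xx) (trans (sym (X≗K y)) Xy))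
        (λ x y Yx Yy → proj₂ (proj₂ split) x y (trans (cong not (sym (X≗K x))) Yx) (trans (cong not (sym (X≗K y))) Yy))
        (≤-antisym (≤-trans (sorted v jw (subst (toℕ v ≤_) (sym jw-pos) (s≤s⁻¹ (large⇒early v (≤-reflexive (sym dv))))))
                            (≤-reflexive dv))
                   (K-large jw jw∈K))

    -- Part A stable: then the neighbours of v have degree > k₀, so they are
    -- the first k₀ vertices, and the vertex jw at index k₀ is adjacent to
    -- all of them.
    module WithLowStable (low-stable : LowStable (suc k₀)) where

      nbr-large : ∀ x → adj G v x ≡ true → suc k₀ ≤ d x
      nbr-large x vx = ≤∧≢⇒< (K-large x (nbr-in-K vx)) λ k₀≡dx →
        true≢false (trans (adj-sym G x v) vx) (low-stable x v (sym k₀≡dx) dv)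

      non-nbr-small : ∀ x → adj G v x ≡ false → d x ≤ k₀
      non-nbr-small x vx with x Fin.≟ v
      ... | yes refl = ≤-reflexive dv
      ... | no x≢v   = outside-small x (outside-K x≢v vx)

      threshold : count (λ i → suc k₀ ≤ᵇ d i) ≡ k₀
      threshold = trans (count-cong same) (proj₁ split)
        where
        same : ∀ i → (suc k₀ ≤ᵇ d i) ≡ adj G v i
        same i with adj G v i in vi
        ... | true  = ≤ᵇ-true (nbr-large i vi)
        ... | false = ≤ᵇ-false (λ k₀<di → <⇒≱ k₀<di (non-nbr-small i vi))

      open NonIncreasing d sorted (suc k₀) k₀ threshold

      early-nbr : ∀ i → toℕ i < k₀ → adj G v i ≡ true
      early-nbr i early with adj G v i in vi
      ... | true  = refl
      ... | false = ⊥-elim (<⇒≱ (early⇒large i early) (non-nbr-small i vi))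

      late-small : ∀ i → ¬ toℕ i < k₀ → d i ≤ k₀
      late-small i late with adj G v i in vi
      ... | false = non-nbr-small i vi
      ... | true  = ⊥-elim (late (large⇒early i (nbr-large i vi)))

      djw : d jw ≡ k₀
      djw = ≤-antisym (late-small jw λ jw<k₀ → <-irrefl jw-pos jw<k₀)
        (≤-trans (≤-reflexive (sym dv)) (sorted jw v (subst (_≤ toℕ v) (sym jw-pos) k₀≤v)))
        where
        k₀≤v : k₀ ≤ toℕ v
        k₀≤v = ≮⇒≥ λ v<k₀ → true≢false (early-nbr v v<k₀) (adj-irrefl G v)

      m≡ : m ≡ suc k₀
      m≡ = m-from (≤-reflexive (sym djw)) λ i late → late-small i λ i<k₀ → <⇒≱ (m≤n⇒m≤1+n i<k₀) late

      X-nbr : ∀ x → X x ≡ true → x ≢ jw → adj G v x ≡ true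
      X-nbr x Xx x≢jw = early-nbr x (≤∧≢⇒< (s≤s⁻¹ (subst (toℕ x <_) m≡ (<ᵇ-sound Xx)))
                                           (λ x≡k₀ → x≢jw (toℕ-injective (trans x≡k₀ (sym jw-pos)))))

      -- jw is adjacent to every neighbour of v: either jw = v, or jw lies
      -- outside K and its k₀ neighbours are exactly those of v.
      jw-adj : ∀ y → adj G v y ≡ true → adj G jw y ≡ true
      jw-adj y vy with adj G v jw in vjw
      ... | true  = ⊥-elim (<⇒≱ (nbr-large jw vjw) (≤-reflexive djw))
      ... | false with jw Fin.≟ v
      ...   | yes jw≡v = subst (λ z → adj G z y ≡ true) (sym jw≡v) vy
      ...   | no jw≢v  = count-⊆-eq (outside-nbrs jw (outside-K jw≢v vjw))
                           (≤-reflexive (trans (proj₁ split) (trans (sym djw) (degree jw)))) y vy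

      clique : Clique G X
      clique x y x≢y Xx Xy with x Fin.≟ jw | y Fin.≟ jw
      ... | yes refl | yes refl = contradiction refl x≢y
      ... | yes refl | no y≢jw  = jw-adj y (X-nbr y Xy y≢jw)
      ... | no x≢jw  | yes refl = trans (adj-sym G x jw) (jw-adj x (X-nbr x Xx x≢jw))
      ... | no x≢jw  | no y≢jw  =
        proj₁ (proj₂ split) x y x≢y (nbr-in-K (X-nbr x Xx x≢jw)) (nbr-in-K (X-nbr y Xy y≢jw))

      Y-non-nbr : ∀ x → Y x ≡ true → adj G v x ≡ false
      Y-non-nbr x Yx with adj G v x in vx
      ... | false = refl
      ... | true  = ⊥-elim (true≢false
        (<ᵇ-true (subst (toℕ x <_) (sym m≡) (m≤n⇒m≤1+n (large⇒early x (nbr-large x vx))))) (not-true Yx))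

      -- Y consists of v and vertices outside K.
      stable : Stable G Y
      stable x y Yx Yy with x Fin.≟ v | y Fin.≟ v
      ... | yes refl | yes refl = adj-irrefl G v
      ... | yes refl | no _     = Y-non-nbr y Yy
      ... | no _     | yes refl = trans (adj-sym G x v) (Y-non-nbr x Yx)
      ... | no x≢v   | no y≢v   = proj₂ (proj₂ split) x y
        (not-false (outside-K x≢v (Y-non-nbr x Yx))) (not-false (outside-K y≢v (Y-non-nbr y Yy)))

      result : DegreeCondition
      result = finish m≡ clique stable djw

  sizes⇒n≡ : ∀ {k₀ k₁} → suc k₀ + suc k₁ ≡ n + 1 → n ≡ suc (k₀ + k₁)
  sizes⇒n≡ {k₀} {k₁} sizes = sym (suc-injective (trans (cong suc (sym (+-suc k₀ k₁))) (trans sizes (+-comm n 1))))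

  forward : ∀ {k k′} → IsChromatic G k → IsChromatic H k′ → k + k′ ≡ n + 1 →
    LowClique k ⊎ LowStable k → DegreeCondition
  forward {zero}            χG _  _     _ = ⊥-elim (FinP.¬Fin0 (proj₁ (proj₁ χG) w))
  forward {suc k₀} {zero}   _  χH _     _ = ⊥-elim (FinP.¬Fin0 (proj₁ (proj₁ χH) w))
  forward {suc k₀} {suc k₁} χG χH sizes (inj₁ low-clique) =
    FromSplit.WithLowClique.result k₀ (proj₁ split) (proj₂ split) low-clique
    where
    open Structure GH (sizes⇒n≡ sizes) (uncolourable-below G χG) (uncolourable-below H χH)
      (λ u v u≢v du dv → low-clique u v u≢v (trans (degree u) du) (trans (degree v) dv))
      using (split)
  forward {suc k₀} {suc k₁} χG χH sizes (inj₂ low-stable) =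
    FromSplit.WithLowStable.result k₀ (proj₁ split) (split-complement GH n≡ (proj₂ split)) low-stable
    where
    n≡ : n ≡ suc (k₀ + k₁)
    n≡ = sizes⇒n≡ sizes
    -- In H the low vertices (H-degree k₁) are those of G-degree k₀: an H-clique.
    low-in-H : ∀ u → count (adj H u) ≡ k₁ → d u ≡ k₀
    low-in-H u du = trans (degree u) (degree-complement GH n≡ u du)
    open Structure (complementary-sym GH) (trans n≡ (cong suc (+-comm k₀ k₁)))
      (uncolourable-below H χH) (uncolourable-below G χG)
      (λ u v u≢v du dv → adj-one GH u v u≢v (low-stable u v (low-in-H u du) (low-in-H v dv)))
      using (split)

  backward : DegreeCondition → Σ ℕ λ k′ →
    IsChromatic G m × IsChromatic H k′ × m + k′ ≡ n + 1 × (LowClique m ⊎ LowStable m)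
  backward cond = k′ , G-chromatic , H-chromatic , sizes , low-clique-or-stable
    where
    open FromCondition (proj₁ (condition⇒split cond)) (proj₂ (condition⇒split cond)) (proj₂ cond w w-pos)

complement-complementary : ∀ {n} (G : Graph n) → Complementary G (complement G)
complement-complementary G = record { adj-one = one ; adj-not-both = not-both }
  where
  one : ∀ u v → u ≢ v → adj G u v ≡ false → adj (complement G) u v ≡ true
  one u v u≢v Guv with u Fin.≟ v
  ... | yes u≡v = contradiction u≡v u≢v
  ... | no _    = cong not Guv
  not-both : ∀ u v → adj G u v ≡ true → adj (complement G) u v ≡ false
  not-both u v Guv with u Fin.≟ v
  ... | yes _ = refl
  ... | no _  = cong not Guv

relabel : ∀ {n} → Graph n → (Fin n → Fin n) → Graph n
relabel G π = record
  { adj        = λ i j → adj G (π i) (π j)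
  ; adj-sym    = λ i j → adj-sym G (π i) (π j)
  ; adj-irrefl = λ i → adj-irrefl G (π i)
  }

module Relabelling {n} (π ρ : Fin n → Fin n) (πρ : ∀ i → π (ρ i) ≡ i) (ρπ : ∀ i → ρ (π i) ≡ i) where

  π-injective : ∀ {i j} → π i ≡ π j → i ≡ j
  π-injective {i} {j} eq = trans (sym (ρπ i)) (trans (cong ρ eq) (ρπ j))

  colourable-to : ∀ (G : Graph n) {k} → Colourable G k → Colourable (relabel G π) k
  colourable-to G (c , proper) = c ∘ π , λ i j → proper (π i) (π j)

  colourable-from : ∀ (G : Graph n) {k} → Colourable (relabel G π) k → Colourable G k
  colourable-from G (c , proper) = c ∘ ρ , λ u v uv →
    proper (ρ u) (ρ v) (subst₂ (λ x y → adj G x y ≡ true) (sym (πρ u)) (sym (πρ v)) uv)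

  chromatic-to : ∀ (G : Graph n) {k} → IsChromatic G k → IsChromatic (relabel G π) k
  chromatic-to G (c , least) = colourable-to G c , λ j c′ → least j (colourable-from G c′)

  chromatic-from : ∀ (G : Graph n) {k} → IsChromatic (relabel G π) k → IsChromatic G k
  chromatic-from G (c , least) = colourable-from G c , λ j c′ → least j (colourable-to G c′)

  complementary-relabel : ∀ {G H : Graph n} → Complementary G H → Complementary (relabel G π) (relabel H π)
  complementary-relabel GH = record
    { adj-one      = λ i j i≢j → adj-one GH (π i) (π j) (λ eq → i≢j (π-injective eq))
    ; adj-not-both = λ i j → adj-not-both GH (π i) (π j)
    }

  degree-relabel : ∀ (G : Graph n) i → deg G (π i) ≡ count (adj (relabel G π) i)
  degree-relabel G i = trans (sum-toList (λ u → bit (adj G (π i) u)))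
    (sum-permute (λ u → bit (adj G (π i) u)) (permutation π ρ πρ ρπ))

chromatic-unique : ∀ {n} (G : Graph n) {k k′} → IsChromatic G k → IsChromatic G k′ → k′ ≡ k
chromatic-unique G χ χ′ = ≤-antisym (proj₂ χ′ _ (proj₁ χ)) (proj₂ χ _ (proj₁ χ′))

-- The theorem for G with sorted degree sequence d: list the vertices in
-- the order of d (vertex i of the relabelled graph has degree d i) and
-- apply the forward and backward directions there.
module Corollary {n} (G : Graph n) (d : Fin n → ℕ) (m : ℕ) (sd : IsSortedDegSeq G d) (isM : IsM d m) where

  π ρ : Fin n → Fin n
  π = proj₁ (proj₁ sd)
  ρ = proj₁ (proj₁ (proj₂ (proj₁ sd)))

  πρ : ∀ u → π (ρ u) ≡ u
  πρ = proj₁ (proj₂ (proj₁ (proj₂ (proj₁ sd))))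

  ρπ : ∀ i → ρ (π i) ≡ i
  ρπ = proj₂ (proj₂ (proj₁ (proj₂ (proj₁ sd))))

  d-π : ∀ i → d i ≡ deg G (π i)
  d-π = proj₂ (proj₂ (proj₁ sd))

  open Relabelling π ρ πρ ρπ

  open SortedGraph (complementary-relabel (complement-complementary G)) d
    (λ i → trans (d-π i) (degree-relabel G i)) (proj₂ sd) m isM

  A-π : ∀ k {u} → d u ≡ k ∸ 1 → InA G k (π u)
  A-π k {u} du = trans (sym (d-π u)) du

  A-ρ : ∀ k {u} → InA G k u → d (ρ u) ≡ k ∸ 1
  A-ρ k {u} Au = trans (d-π (ρ u)) (trans (cong (deg G) (πρ u)) Au)

  ρ-injective : ∀ {u v} → ρ u ≡ ρ v → u ≡ v
  ρ-injective {u} {v} eq = trans (sym (πρ u)) (trans (cong π eq) (πρ v))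

  ng⇒condition : IsNG1 G ⊎ IsNG2 G → DegreeCondition
  ng⇒condition (inj₁ ((k , k′ , χG , χḠ , sizes) , k₂ , χG₂ , A-clique))
    rewrite chromatic-unique G χG χG₂ =
    forward (chromatic-to G χG) (chromatic-to (complement G) χḠ) sizes
      (inj₁ λ u v u≢v du dv → A-clique (π u) (π v) (λ eq → u≢v (π-injective eq)) (A-π k du) (A-π k dv))
  ng⇒condition (inj₂ ((k , k′ , χG , χḠ , sizes) , k₂ , χG₂ , A-stable))
    rewrite chromatic-unique G χG χG₂ =
    forward (chromatic-to G χG) (chromatic-to (complement G) χḠ) sizes
      (inj₂ λ u v du dv → A-stable (π u) (π v) (A-π k du) (A-π k dv))

  condition⇒ng : DegreeCondition → IsNG1 G ⊎ IsNG2 G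
  condition⇒ng cond with backward cond
  ... | k′ , χG , χH , sizes , low = Data.Sum.map (λ low-clique → ng , m , chromatic-from G χG , A-clique low-clique)
                                                   (λ low-stable → ng , m , chromatic-from G χG , A-stable low-stable) low
    where
    ng : IsNG G
    ng = m , k′ , chromatic-from G χG , chromatic-from (complement G) χH , sizes
    A-clique : LowClique m → ∀ u v → u ≢ v → InA G m u → InA G m v → adj G u v ≡ true
    A-clique low-clique u v u≢v Au Av = subst₂ (λ x y → adj G x y ≡ true) (πρ u) (πρ v)
      (low-clique (ρ u) (ρ v) (λ eq → u≢v (ρ-injective eq)) (A-ρ m Au) (A-ρ m Av))
    A-stable : LowStable m → ∀ u v → InA G m u → InA G m v → adj G u v ≡ false
    A-stable low-stable u v Au Av = subst₂ (λ x y → adj G x y ≡ false) (πρ u) (πρ v)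
      (low-stable (ρ u) (ρ v) (A-ρ m Au) (A-ρ m Av))

corollary3p7 : (n : ℕ) (G : Graph n) (d : Fin n → ℕ) (m : ℕ) →
    IsSortedDegSeq G d → IsM d m →
    ((IsNG1 G ⊎ IsNG2 G) ⇔
      ((sumUpTo d m ≡ m * (m ∸ 1) + sumFrom d m) × DmIs d m))
corollary3p7 n G d m sd isM = mk⇔ ng⇒condition condition⇒ng
  where open Corollary G d m sd isM
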